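{- For all integers $n\ge 0$ and $k\ge 0$: if $k\equiv 0$ or $3\pmod 4$ then $L(n,k)=e(n,k)$, and if $k\equiv 1$ or $2\pmod 4$ then $L(n,k)=o(n,k)$.
   Context: $e(n,k)$ (resp. $o(n,k)$) is the number of $k$-subsets of $\{1,\dots,n\}$ whose element sum is even (resp. odd); the empty set counts as even, and both are $0$ for $k<0$ or $k>n$. Losanitsch's triangle $(L(n,k))_{n\ge0,\,k\in\mathbb Z}$ is defined by $L(0,k)=[k=0]$, $L(1,k)=[0\le k\le 1]$, $L(n,k)=0$ for $k<0$, and for $n\ge 2$ by the recursion $L(n,k)=L(n-2,k)+\binom{n-2}{k-1}+L(n-2,k-2)$ (with $\binom{m}{j}=0$ for $j<0$ or $j>m$). -}

module Defs where

open import Data.Nat using (ℕ; zero; suc; _+_; _%_)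
open import Data.Nat.Combinatorics using (_C_)
open import Data.Bool using (Bool; true; false; if_then_else_)
open import Data.Fin using (Fin; toℕ)
open import Data.Fin.Subset using (Subset; inside; outside; ∣_∣)
open import Data.Vec using (Vec; []; _∷_; tabulate; zipWith; foldr)
open import Data.List using (List; []; _∷_; map; _++_; filter; length)
open import Relation.Nullary using (Dec; yes; no)
open import Relation.Nullary.Decidable using (_×-dec_)
open import Data.Nat using (_≟_)

allSubsets : (n : ℕ) → List (Subset n)
allSubsets zero = [] ∷ []
allSubsets (suc n) = map (outside ∷_) (allSubsets n) ++ map (inside ∷_) (allSubsets n)

-- Fin n represents {1,…,n} via i ↦ toℕ i + 1.
-- Element sum of a subset of {1,…,n}.
elemSum : {n : ℕ} → Subset n → ℕ
elemSum {n} p = foldr _ _+_ 0 (zipWith (λ b (i : Fin n) → if b then suc (toℕ i) else 0) p (tabulate (λ i → i)))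

e : ℕ → ℕ → ℕ
e n k = length (filter (λ p → (∣ p ∣ ≟ k) ×-dec (elemSum p % 2 ≟ 0)) (allSubsets n))

o : ℕ → ℕ → ℕ
o n k = length (filter (λ p → (∣ p ∣ ≟ k) ×-dec (elemSum p % 2 ≟ 1)) (allSubsets n))

-- Losanitsch's triangle L(n,k) for k ≥ 0 (values for k < 0 are 0 and
-- are encoded by the "k-1", "k-2" cases below).
L : ℕ → ℕ → ℕ
L zero zero = 1
L zero (suc k) = 0
L (suc zero) zero = 1
L (suc zero) (suc zero) = 1
L (suc zero) (suc (suc k)) = 0
-- L(n,0) = L(n-2,0) + C(n-2,-1) + L(n-2,-2) = L(n-2,0)
L (suc (suc n)) zero = L n zero
-- L(n,1) = L(n-2,1) + C(n-2,0) + L(n-2,-1)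
L (suc (suc n)) (suc zero) = L n 1 + n C 0
L (suc (suc n)) (suc (suc k)) = L n (suc (suc k)) + n C (suc k) + L n k

module Submission where

-- Write count n k π for the number of k-subsets of {1,…,n} whose element
-- sum has parity π, so that e n k = count n k 0ℙ and o n k = count n k 1ℙ.
-- Splitting the subsets of {1,…,n+1} according to whether they contain 1,
-- and identifying the rest with a subset of {1,…,n} shifted up by one
-- (which adds the size k to the element sum), gives a one-step recursion
-- for count.  Applied twice it becomes Losanitsch's recursion
--   count (n+2) k π = count n k π + C(n,k-1) + count n (k-2) (π⁻¹),
-- the middle term being the total number of (k-1)-subsets of {1,…,n}.
-- Hence L n k = count n k (triParity k) by induction on n, where
-- triParity k is the parity of 1+2+⋯+k, which is 0,1,1,0 for k ≡ 0,1,2,3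
-- (mod 4).

open import Defs
open import Data.Nat using (ℕ; _%_)
open import Data.Sum using (_⊎_)
open import Data.Product using (_×_)
open import Relation.Binary.PropositionalEquality using (_≡_)

open import Data.Nat using (zero; suc; _+_; _≟_; parity)
open import Data.Nat.Properties using (+-suc; +-assoc; +-comm; +-identityʳ; suc-injective; +-commutativeSemigroup)
open import Algebra.Properties.CommutativeSemigroup +-commutativeSemigroup using (interchange)
open import Data.Nat.Combinatorics using (_C_; nCk+nC[k+1]≡[n+1]C[k+1])
open import Data.Parity.Base as ℙ using (Parity; 0ℙ; 1ℙ; _⁻¹)
open import Data.Parity.Properties using (+-homo-+; suc-homo-⁻¹; ⁻¹-involutive; p+p≡0ℙ)
  renaming (_≟_ to _≟ℙ_; +-assoc to ℙ+-assoc; +-identityʳ to ℙ+-identityʳ)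
open import Data.Bool using (Bool; if_then_else_)
open import Data.Fin using (Fin; toℕ) renaming (zero to fzero; suc to fsuc)
open import Data.Fin.Subset using (Subset; inside; outside; ∣_∣)
open import Data.Vec using ([]; _∷_; tabulate; zipWith; foldr)
open import Data.List using (List; []; _∷_; map; filter; length; _++_)
open import Data.List.Properties using (filter-++; filter-≐; length-++)
open import Data.Product using (_,_)
open import Data.Sum using (inj₁; inj₂)
open import Relation.Nullary using (yes; no)
open import Relation.Nullary.Decidable using (_×-dec_)
open import Relation.Unary using (Decidable; _≐_)
open import Relation.Binary.PropositionalEquality using (refl; sym; trans; cong; cong₂)
open import Function using (_∘_)
open Relation.Binary.PropositionalEquality.≡-Reasoning

private
  variable
    n : ℕ

weightedSum : (Fin n → ℕ) → Subset n → ℕ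
weightedSum w []      = 0
weightedSum w (b ∷ p) = (if b then w fzero else 0) + weightedSum (w ∘ fsuc) p

sum-zipWith-tabulate : {A : Set} (f : A → ℕ) (h : Fin n → A) (p : Subset n) →
  foldr (λ _ → ℕ) _+_ 0 (zipWith (λ b x → if b then f x else 0) p (tabulate h))
    ≡ weightedSum (f ∘ h) p
sum-zipWith-tabulate f h []      = refl
sum-zipWith-tabulate f h (b ∷ p) = cong (_ +_) (sum-zipWith-tabulate f (h ∘ fsuc) p)

elemSum≡weightedSum : (p : Subset n) → elemSum p ≡ weightedSum (suc ∘ toℕ) p
elemSum≡weightedSum = sum-zipWith-tabulate (suc ∘ toℕ) (λ i → i)

weightedSum-suc : (w : Fin n → ℕ) (p : Subset n) →
  weightedSum (suc ∘ w) p ≡ weightedSum w p + ∣ p ∣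
weightedSum-suc w []            = refl
weightedSum-suc w (outside ∷ p) = weightedSum-suc (w ∘ fsuc) p
weightedSum-suc w (inside ∷ p)  = begin
  suc (w fzero + weightedSum (suc ∘ w ∘ fsuc) p)
    ≡⟨ cong (λ s → suc (w fzero + s)) (weightedSum-suc (w ∘ fsuc) p) ⟩
  suc (w fzero + (weightedSum (w ∘ fsuc) p + ∣ p ∣))
    ≡⟨ cong suc (sym (+-assoc (w fzero) _ ∣ p ∣)) ⟩
  suc (w fzero + weightedSum (w ∘ fsuc) p + ∣ p ∣)
    ≡⟨ sym (+-suc _ ∣ p ∣) ⟩
  w fzero + weightedSum (w ∘ fsuc) p + suc ∣ p ∣ ∎

-- Adjoining a new least element b: the old elements {1,…,n} move to
-- {2,…,n+1}, adding one per element, and the new element 1 adds 1 if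
-- present; in total the size of the new subset is added.
elemSum-∷ : (b : Bool) (p : Subset n) → elemSum (b ∷ p) ≡ elemSum p + ∣ b ∷ p ∣
elemSum-∷ b p = begin
  elemSum (b ∷ p)                                       ≡⟨ elemSum≡weightedSum (b ∷ p) ⟩
  [ b ] + weightedSum (suc ∘ suc ∘ toℕ) p               ≡⟨ cong ([ b ] +_) (weightedSum-suc (suc ∘ toℕ) p) ⟩
  [ b ] + (weightedSum (suc ∘ toℕ) p + ∣ p ∣)           ≡⟨ cong (λ s → [ b ] + (s + ∣ p ∣)) (sym (elemSum≡weightedSum p)) ⟩
  [ b ] + (elemSum p + ∣ p ∣)                           ≡⟨ absorb b ⟩
  elemSum p + ∣ b ∷ p ∣                                 ∎
  where
  [_] : Bool → ℕ
  [ b ] = if b then 1 else 0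
  absorb : (b : Bool) → [ b ] + (elemSum p + ∣ p ∣) ≡ elemSum p + ∣ b ∷ p ∣
  absorb outside = refl
  absorb inside  = sym (+-suc (elemSum p) ∣ p ∣)

-- Parities form the group ℤ/2, in which every element is its own inverse.
+-cancel-twice : (π c : Parity) → (π ℙ.+ c) ℙ.+ c ≡ π
+-cancel-twice π c = begin
  (π ℙ.+ c) ℙ.+ c  ≡⟨ ℙ+-assoc π c c ⟩
  π ℙ.+ (c ℙ.+ c)  ≡⟨ cong (π ℙ.+_) (p+p≡0ℙ c) ⟩
  π ℙ.+ 0ℙ         ≡⟨ ℙ+-identityʳ π ⟩
  π                ∎

-- The parities of two consecutive numbers add up to 1ℙ, so adding both
-- flips a parity.
+-consecutive : (π : Parity) (k : ℕ) → (π ℙ.+ parity (suc k)) ℙ.+ parity k ≡ π ⁻¹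
+-consecutive π k = begin
  (π ℙ.+ parity (suc k)) ℙ.+ parity k          ≡⟨ cong ((π ℙ.+ parity (suc k)) ℙ.+_) (sym (suc-homo-⁻¹ k)) ⟩
  (π ℙ.+ parity (suc k)) ℙ.+ parity (suc k) ⁻¹ ≡⟨ +-then-opposite π (parity (suc k)) ⟩
  π ⁻¹                                         ∎
  where
  +-then-opposite : (π c : Parity) → (π ℙ.+ c) ℙ.+ c ⁻¹ ≡ π ⁻¹
  +-then-opposite 0ℙ 0ℙ = refl
  +-then-opposite 0ℙ 1ℙ = refl
  +-then-opposite 1ℙ 0ℙ = refl
  +-then-opposite 1ℙ 1ℙ = refl

⁻¹-+ : (π c : Parity) → π ⁻¹ ℙ.+ c ≡ (π ℙ.+ c) ⁻¹
⁻¹-+ 0ℙ c = refl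
⁻¹-+ 1ℙ c = sym (⁻¹-involutive c)

parity-elemSum-∷ : (b : Bool) (p : Subset n) (π : Parity) →
  parity (elemSum (b ∷ p)) ≡ π → parity (elemSum p) ≡ π ℙ.+ parity ∣ b ∷ p ∣
parity-elemSum-∷ b p π eq = begin
  parity (elemSum p)                    ≡⟨ sym (+-cancel-twice _ c) ⟩
  (parity (elemSum p) ℙ.+ c) ℙ.+ c      ≡⟨ cong (ℙ._+ c) (sym (+-homo-+ (elemSum p) ∣ b ∷ p ∣)) ⟩
  parity (elemSum p + ∣ b ∷ p ∣) ℙ.+ c  ≡⟨ cong (λ s → parity s ℙ.+ c) (sym (elemSum-∷ b p)) ⟩
  parity (elemSum (b ∷ p)) ℙ.+ c        ≡⟨ cong (ℙ._+ c) eq ⟩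
  π ℙ.+ c                               ∎
  where c = parity ∣ b ∷ p ∣

parity-elemSum-∷⁻ : (b : Bool) (p : Subset n) (π : Parity) →
  parity (elemSum p) ≡ π ℙ.+ parity ∣ b ∷ p ∣ → parity (elemSum (b ∷ p)) ≡ π
parity-elemSum-∷⁻ b p π eq = begin
  parity (elemSum (b ∷ p))        ≡⟨ cong parity (elemSum-∷ b p) ⟩
  parity (elemSum p + ∣ b ∷ p ∣)  ≡⟨ +-homo-+ (elemSum p) ∣ b ∷ p ∣ ⟩
  parity (elemSum p) ℙ.+ c        ≡⟨ cong (ℙ._+ c) eq ⟩
  (π ℙ.+ c) ℙ.+ c                 ≡⟨ +-cancel-twice π c ⟩
  π                               ∎
  where c = parity ∣ b ∷ p ∣

HasShape : ℕ → Parity → Subset n → Set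
HasShape k π p = ∣ p ∣ ≡ k × parity (elemSum p) ≡ π

hasShape? : (k : ℕ) (π : Parity) → Decidable (HasShape {n} k π)
hasShape? k π p = (∣ p ∣ ≟ k) ×-dec (parity (elemSum p) ≟ℙ π)

countIn : List (Subset n) → ℕ → Parity → ℕ
countIn xs k π = length (filter (hasShape? k π) xs)

count : ℕ → ℕ → Parity → ℕ
count n k π = countIn (allSubsets n) k π

length-filter-map : {A B : Set} {P : B → Set} (P? : Decidable P) (f : A → B) (xs : List A) →
  length (filter P? (map f xs)) ≡ length (filter (P? ∘ f) xs)
length-filter-map P? f []       = refl
length-filter-map P? f (x ∷ xs) with P? (f x)
... | yes _ = cong suc (length-filter-map P? f xs)
... | no _  = length-filter-map P? f xs

shape-outside : (k : ℕ) (π : Parity) →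
  (HasShape k π ∘ (outside ∷_)) ≐ HasShape {n} k (π ℙ.+ parity k)
shape-outside k π = (λ {p} → forward {p}) , (λ {p} → backward {p})
  where
  forward : ∀ {p} → HasShape k π (outside ∷ p) → HasShape k (π ℙ.+ parity k) p
  forward {p} (size , par) =
    size , trans (parity-elemSum-∷ outside p π par) (cong (λ m → π ℙ.+ parity m) size)
  backward : ∀ {p} → HasShape k (π ℙ.+ parity k) p → HasShape k π (outside ∷ p)
  backward {p} (size , par) =
    size , parity-elemSum-∷⁻ outside p π (trans par (cong (λ m → π ℙ.+ parity m) (sym size)))

shape-inside : (k : ℕ) (π : Parity) →
  (HasShape (suc k) π ∘ (inside ∷_)) ≐ HasShape {n} k (π ℙ.+ parity (suc k))
shape-inside k π = (λ {p} → forward {p}) , (λ {p} → backward {p})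
  where
  forward : ∀ {p} → HasShape (suc k) π (inside ∷ p) → HasShape k (π ℙ.+ parity (suc k)) p
  forward {p} (size , par) =
    suc-injective size , trans (parity-elemSum-∷ inside p π par) (cong (λ m → π ℙ.+ parity m) size)
  backward : ∀ {p} → HasShape k (π ℙ.+ parity (suc k)) p → HasShape (suc k) π (inside ∷ p)
  backward {p} (size , par) =
    cong suc size , parity-elemSum-∷⁻ inside p π (trans par (cong (λ m → π ℙ.+ parity (suc m)) (sym size)))

countIn-outside : (k : ℕ) (π : Parity) (xs : List (Subset n)) →
  countIn (map (outside ∷_) xs) k π ≡ countIn xs k (π ℙ.+ parity k)
countIn-outside k π xs =
  trans (length-filter-map (hasShape? k π) (outside ∷_) xs)
        (cong length (filter-≐ _ (hasShape? k (π ℙ.+ parity k)) (shape-outside k π) xs))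

countIn-inside : (k : ℕ) (π : Parity) (xs : List (Subset n)) →
  countIn (map (inside ∷_) xs) (suc k) π ≡ countIn xs k (π ℙ.+ parity (suc k))
countIn-inside k π xs =
  trans (length-filter-map (hasShape? (suc k) π) (inside ∷_) xs)
        (cong length (filter-≐ _ (hasShape? k (π ℙ.+ parity (suc k))) (shape-inside k π) xs))

-- A subset containing 1 is never empty.
countIn-inside-empty : (π : Parity) (xs : List (Subset n)) → countIn (map (inside ∷_) xs) 0 π ≡ 0
countIn-inside-empty π []       = refl
countIn-inside-empty π (p ∷ xs) = countIn-inside-empty π xs

count-split : (n k : ℕ) (π : Parity) →
  count (suc n) k π ≡ countIn (map (outside ∷_) (allSubsets n)) k π + countIn (map (inside ∷_) (allSubsets n)) k π
count-split n k π =
  trans (cong length (filter-++ (hasShape? k π) (map (outside ∷_) (allSubsets n)) _))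
        (length-++ (filter (hasShape? k π) (map (outside ∷_) (allSubsets n))))

count-suc-zero : (n : ℕ) (π : Parity) → count (suc n) 0 π ≡ count n 0 (π ℙ.+ parity 0)
count-suc-zero n π = begin
  count (suc n) 0 π                             ≡⟨ count-split n 0 π ⟩
  countIn (map (outside ∷_) A) 0 π + countIn (map (inside ∷_) A) 0 π
                                                ≡⟨ cong₂ _+_ (countIn-outside 0 π A) (countIn-inside-empty π A) ⟩
  count n 0 (π ℙ.+ parity 0) + 0                ≡⟨ +-identityʳ _ ⟩
  count n 0 (π ℙ.+ parity 0)                    ∎
  where A = allSubsets n

-- One-step recursion: a (k+1)-subset of {1,…,n+1} either omits 1 and comes
-- from a (k+1)-subset of {1,…,n}, or contains 1 and comes from a k-subset;
-- in both cases the parity shifts by that of k+1.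
count-suc-suc : (n k : ℕ) (π : Parity) →
  count (suc n) (suc k) π ≡ count n (suc k) (π ℙ.+ parity (suc k)) + count n k (π ℙ.+ parity (suc k))
count-suc-suc n k π =
  trans (count-split n (suc k) π)
        (cong₂ _+_ (countIn-outside (suc k) π (allSubsets n)) (countIn-inside k π (allSubsets n)))

count-total : (n k : ℕ) (π : Parity) → count n k π + count n k (π ⁻¹) ≡ n C k
count-total zero    zero    0ℙ = refl
count-total zero    zero    1ℙ = refl
count-total zero    (suc k) 0ℙ = refl
count-total zero    (suc k) 1ℙ = refl
count-total (suc n) zero    π  = begin
  count (suc n) 0 π + count (suc n) 0 (π ⁻¹)               ≡⟨ cong₂ _+_ (count-suc-zero n π) (count-suc-zero n (π ⁻¹)) ⟩
  count n 0 π′ + count n 0 (π ⁻¹ ℙ.+ parity 0)             ≡⟨ cong (λ ρ → count n 0 π′ + count n 0 ρ) (⁻¹-+ π (parity 0)) ⟩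
  count n 0 π′ + count n 0 (π′ ⁻¹)                         ≡⟨ count-total n 0 π′ ⟩
  n C 0                                                    ∎
  where π′ = π ℙ.+ parity 0
count-total (suc n) (suc k) π = begin
  count (suc n) (suc k) π + count (suc n) (suc k) (π ⁻¹)
    ≡⟨ cong₂ _+_ (count-suc-suc n k π) (count-suc-suc n k (π ⁻¹)) ⟩
  (count n (suc k) π′ + count n k π′) + (count n (suc k) (π ⁻¹ ℙ.+ c) + count n k (π ⁻¹ ℙ.+ c))
    ≡⟨ cong (λ ρ → (count n (suc k) π′ + count n k π′) + (count n (suc k) ρ + count n k ρ)) (⁻¹-+ π c) ⟩
  (count n (suc k) π′ + count n k π′) + (count n (suc k) (π′ ⁻¹) + count n k (π′ ⁻¹))
    ≡⟨ interchange (count n (suc k) π′) _ _ _ ⟩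
  (count n (suc k) π′ + count n (suc k) (π′ ⁻¹)) + (count n k π′ + count n k (π′ ⁻¹))
    ≡⟨ cong₂ _+_ (count-total n (suc k) π′) (count-total n k π′) ⟩
  n C suc k + n C k
    ≡⟨ +-comm (n C suc k) (n C k) ⟩
  n C k + n C suc k
    ≡⟨ nCk+nC[k+1]≡[n+1]C[k+1] n k ⟩
  suc n C suc k
    ∎
  where
  c  = parity (suc k)
  π′ = π ℙ.+ c

-- Removing the possible elements 1 and 2 of a
-- k-subset of {1,…,n+2}: if neither or both are present the parity is
-- restored resp. flipped, and the subsets containing exactly one of them
-- are all the (k-1)-subsets of {1,…,n}, regardless of parity.  This is
-- Losanitsch's recursion, with the last term taken at the opposite parity.
count-two-zero : (n : ℕ) (π : Parity) → count (suc (suc n)) 0 π ≡ count n 0 π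
count-two-zero n π = begin
  count (suc (suc n)) 0 π                      ≡⟨ count-suc-zero (suc n) π ⟩
  count (suc n) 0 (π ℙ.+ parity 0)             ≡⟨ count-suc-zero n (π ℙ.+ parity 0) ⟩
  count n 0 ((π ℙ.+ parity 0) ℙ.+ parity 0)    ≡⟨ cong (count n 0) (+-cancel-twice π (parity 0)) ⟩
  count n 0 π                                  ∎

count-two-one : (n : ℕ) (π : Parity) → count (suc (suc n)) 1 π ≡ count n 1 π + n C 0
count-two-one n π = begin
  count (suc (suc n)) 1 π
    ≡⟨ count-suc-suc (suc n) 0 π ⟩
  count (suc n) 1 π₁ + count (suc n) 0 π₁
    ≡⟨ cong₂ _+_ (count-suc-suc n 0 π₁) (count-suc-zero n π₁) ⟩
  (count n 1 (π₁ ℙ.+ parity 1) + count n 0 (π₁ ℙ.+ parity 1)) + count n 0 (π₁ ℙ.+ parity 0)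
    ≡⟨ cong₂ (λ ρ σ → (count n 1 ρ + count n 0 ρ) + count n 0 σ) (+-cancel-twice π (parity 1)) (+-consecutive π 0) ⟩
  (count n 1 π + count n 0 π) + count n 0 (π ⁻¹)
    ≡⟨ +-assoc (count n 1 π) _ _ ⟩
  count n 1 π + (count n 0 π + count n 0 (π ⁻¹))
    ≡⟨ cong (count n 1 π +_) (count-total n 0 π) ⟩
  count n 1 π + n C 0
    ∎
  where π₁ = π ℙ.+ parity 1

count-two-suc-suc : (n k : ℕ) (π : Parity) →
  count (suc (suc n)) (suc (suc k)) π ≡ count n (suc (suc k)) π + n C suc k + count n k (π ⁻¹)
count-two-suc-suc n k π = begin
  count (suc (suc n)) (suc (suc k)) π
    ≡⟨ count-suc-suc (suc n) (suc k) π ⟩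
  count (suc n) (suc (suc k)) π₁ + count (suc n) (suc k) π₁
    ≡⟨ cong₂ _+_ (count-suc-suc n (suc k) π₁) (count-suc-suc n k π₁) ⟩
  (count n (suc (suc k)) (π₁ ℙ.+ parity (suc (suc k))) + count n (suc k) (π₁ ℙ.+ parity (suc (suc k))))
    + (count n (suc k) (π₁ ℙ.+ parity (suc k)) + count n k (π₁ ℙ.+ parity (suc k)))
    ≡⟨ cong₂ (λ ρ σ → (count n (suc (suc k)) ρ + count n (suc k) ρ) + (count n (suc k) σ + count n k σ))
             (+-cancel-twice π (parity (suc (suc k)))) (+-consecutive π (suc k)) ⟩
  (a + b) + (b′ + d)
    ≡⟨ sym (+-assoc (a + b) b′ d) ⟩
  a + b + b′ + d
    ≡⟨ cong (_+ d) (+-assoc a b b′) ⟩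
  a + (b + b′) + d
    ≡⟨ cong (λ m → a + m + d) (count-total n (suc k) π) ⟩
  a + n C suc k + d
    ∎
  where
  π₁ = π ℙ.+ parity (suc (suc k))
  a  = count n (suc (suc k)) π
  b  = count n (suc k) π
  b′ = count n (suc k) (π ⁻¹)
  d  = count n k (π ⁻¹)

-- The parity of 1 + 2 + ⋯ + k, the element sum of the smallest k-subset;
-- from k to k+2 it changes by (k+1) + (k+2), which is odd.
triParity : ℕ → Parity
triParity zero          = 0ℙ
triParity (suc zero)    = 1ℙ
triParity (suc (suc k)) = triParity k ⁻¹

triParity-mod4 : (k : ℕ) → triParity k ≡ triParity (k % 4)
triParity-mod4 zero                      = refl
triParity-mod4 (suc zero)                = refl
triParity-mod4 (suc (suc zero))          = refl
triParity-mod4 (suc (suc (suc zero)))    = refl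
triParity-mod4 (suc (suc (suc (suc k)))) = trans (⁻¹-involutive (triParity k)) (triParity-mod4 k)

-- Losanitsch's triangle counts the k-subsets of {1,…,n} whose element sum
-- has the parity of 1 + 2 + ⋯ + k: both sides satisfy the same recursion.
L≡count : (n k : ℕ) → L n k ≡ count n k (triParity k)
L≡count zero          zero          = refl
L≡count zero          (suc k)       = refl
L≡count (suc zero)    zero          = refl
L≡count (suc zero)    (suc zero)    = refl
L≡count (suc zero)    (suc (suc k)) = refl
L≡count (suc (suc n)) zero          = trans (L≡count n 0) (sym (count-two-zero n 0ℙ))
L≡count (suc (suc n)) (suc zero)    = trans (cong (_+ n C 0) (L≡count n 1)) (sym (count-two-one n 1ℙ))
L≡count (suc (suc n)) (suc (suc k)) = begin
  L n (suc (suc k)) + n C suc k + L n k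
    ≡⟨ cong₂ (λ x y → x + n C suc k + y) (L≡count n (suc (suc k))) (L≡count n k) ⟩
  count n (suc (suc k)) π + n C suc k + count n k (triParity k)
    ≡⟨ cong (λ ρ → count n (suc (suc k)) π + n C suc k + count n k ρ) (sym (⁻¹-involutive (triParity k))) ⟩
  count n (suc (suc k)) π + n C suc k + count n k (π ⁻¹)
    ≡⟨ sym (count-two-suc-suc n k π) ⟩
  count (suc (suc n)) (suc (suc k)) π
    ∎
  where π = triParity (suc (suc k))

parityToℕ : Parity → ℕ
parityToℕ 0ℙ = 0
parityToℕ 1ℙ = 1

parityToℕ-injective : {π ρ : Parity} → parityToℕ π ≡ parityToℕ ρ → π ≡ ρ
parityToℕ-injective {0ℙ} {0ℙ} _ = refl
parityToℕ-injective {1ℙ} {1ℙ} _ = refl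

%2≡parityToℕ : (m : ℕ) → m % 2 ≡ parityToℕ (parity m)
%2≡parityToℕ zero          = refl
%2≡parityToℕ (suc zero)    = refl
%2≡parityToℕ (suc (suc m)) = %2≡parityToℕ m

count-by-remainder : (n k : ℕ) (π : Parity) →
  length (filter (λ p → (∣ p ∣ ≟ k) ×-dec (elemSum p % 2 ≟ parityToℕ π)) (allSubsets n)) ≡ count n k π
count-by-remainder n k π = cong length (filter-≐ _ (hasShape? k π) ((λ {p} → forward {p}) , (λ {p} → backward {p})) (allSubsets n))
  where
  forward : ∀ {p : Subset n} → ∣ p ∣ ≡ k × elemSum p % 2 ≡ parityToℕ π → HasShape k π p
  forward {p} (size , rem) = size , parityToℕ-injective (trans (sym (%2≡parityToℕ (elemSum p))) rem)
  backward : ∀ {p : Subset n} → HasShape k π p → ∣ p ∣ ≡ k × elemSum p % 2 ≡ parityToℕ π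
  backward {p} (size , par) = size , trans (%2≡parityToℕ (elemSum p)) (cong parityToℕ par)

e≡count : (n k : ℕ) → e n k ≡ count n k 0ℙ
e≡count n k = count-by-remainder n k 0ℙ

o≡count : (n k : ℕ) → o n k ≡ count n k 1ℙ
o≡count n k = count-by-remainder n k 1ℙ

mainTheorem3 : (n k : ℕ) →
    ((k % 4 ≡ 0 ⊎ k % 4 ≡ 3) → L n k ≡ e n k) ×
    ((k % 4 ≡ 1 ⊎ k % 4 ≡ 2) → L n k ≡ o n k)
mainTheorem3 n k = even-case , odd-case
  where
  L≡count-mod4 : {r : ℕ} → k % 4 ≡ r → L n k ≡ count n k (triParity r)
  L≡count-mod4 r = trans (L≡count n k) (cong (count n k) (trans (triParity-mod4 k) (cong triParity r)))

  even-case : (k % 4 ≡ 0 ⊎ k % 4 ≡ 3) → L n k ≡ e n k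
  even-case (inj₁ r) = trans (L≡count-mod4 r) (sym (e≡count n k))
  even-case (inj₂ r) = trans (L≡count-mod4 r) (sym (e≡count n k))

  odd-case : (k % 4 ≡ 1 ⊎ k % 4 ≡ 2) → L n k ≡ o n k
  odd-case (inj₁ r) = trans (L≡count-mod4 r) (sym (o≡count n k))
  odd-case (inj₂ r) = trans (L≡count-mod4 r) (sym (o≡count n k))
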